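{- Let $a,b,c$ be positive integers, let $w_0,w_1$ be arbitrary, and let $\{w_n\}$ be defined by $w_n=aw_{n-1}+cw_{n-2}$ for $n\ge2$ even and $w_n=bw_{n-1}+cw_{n-2}$ for $n\ge2$ odd. Let $\{v_n\}$ satisfy the same recurrence with $v_0=2$, $v_1=b$. Then for integers $n\ge0$ and $k\ge1$, $$w_{n+2k}=\left(\frac ab\right)^{\xi(n+1)\xi(k)}v_k\,w_{n+k}-(-c)^k w_n.$$
   Context: $\xi(n)=n-2\lfloor n/2\rfloor$ is the parity function. $\{v_n\}$ is the generalized bi-periodic Lucas sequence. -}

module Defs where

open import Data.Nat as ℕ using (ℕ; zero; suc; _%_; NonZero)
open import Data.Integer as ℤ using (ℤ; +_)
open import Data.Rational using (ℚ; _+_; _*_; -_; 1ℚ; 0ℚ; _/_)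

ξ : ℕ → ℕ
ξ n = n % 2

infixr 8 _^ℚ_
_^ℚ_ : ℚ → ℕ → ℚ
x ^ℚ zero  = 1ℚ
x ^ℚ suc m = x * (x ^ℚ m)

ℕ→ℚ : ℕ → ℚ
ℕ→ℚ m = (+ m) / 1

-- coefficient used to compute the term with index (m + 2):
-- a if m + 2 is even, b if m + 2 is odd
coef : ℕ → ℕ → ℕ → ℕ
coef a b m with m % 2
... | zero = a
... | suc _ = b

biSeq : (a b c : ℕ) (w0 w1 : ℚ) → ℕ → ℚ
biSeq a b c w0 w1 zero = w0
biSeq a b c w0 w1 (suc zero) = w1
biSeq a b c w0 w1 (suc (suc m)) =
  ℕ→ℚ (coef a b m) * biSeq a b c w0 w1 (suc m) + ℕ→ℚ c * biSeq a b c w0 w1 m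

lucas : (a b c : ℕ) → ℕ → ℚ
lucas a b c = biSeq a b c (ℕ→ℚ 2) (ℕ→ℚ b)

-- Induct on k in steps of two, for all n at once. Expanding w (n + 2k + 4) by the recurrence,
-- its two terms are given by the identity at (n + 1, k + 1) and at (n + 2, k); these share the
-- middle term w (n + k + 2) and recombine through the recurrence for v (k + 2). The parity factors
-- fit because the recurrence coefficient for w (n + 2) is b (a/b)^ξ(n+1), which turns their
-- compatibility into x′ + x y′ = y′ + x′ y for complementary bits x, x′ = 1 - x and y, y′.
-- The identity also holds for k = 0 (as v 0 = 2), and only b ≠ 0 is used, to form a/b.

module Submission where

open import Defs
open import Data.Nat as ℕ using (ℕ; NonZero; _≥_; _+_; zero; suc)
open import Data.Nat.DivMod using ([m+kn]%n≡m%n)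
import Data.Nat.Properties as ℕ
open import Data.Nat.Tactic.RingSolver using (solve-∀)
open import Data.Integer using (+_)
import Data.Integer.Properties as ℤ
open import Data.Rational using (ℚ; _/_; _*_; _-_; -_; 1ℚ; toℚᵘ) renaming (_+_ to _+ℚ_)
open import Data.Rational.Properties using (*-identityˡ; *-identityʳ; *-assoc; *-comm; toℚᵘ-injective; toℚᵘ-homo-*; toℚᵘ-fromℚᵘ)
open import Data.Rational.Solver renaming (module +-*-Solver to ℚ-Solver)
import Data.Rational.Unnormalised as ℚᵘ
import Data.Rational.Unnormalised.Properties as ℚᵘ
open import Data.Product using (_×_; _,_)
open import Data.Sum using (_⊎_; inj₁; inj₂)
open import Relation.Binary.PropositionalEquality using (_≡_; refl; sym; trans; cong; cong₂; module ≡-Reasoning)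

i/n*n≡i : ∀ i n .{{_ : NonZero n}} → (i / n) * ℕ→ℚ n ≡ i / 1
i/n*n≡i i n@(suc n-1) = toℚᵘ-injective (begin
    toℚᵘ ((i / n) * ℕ→ℚ n)                      ≈⟨ toℚᵘ-homo-* (i / n) (ℕ→ℚ n) ⟩
    toℚᵘ (i / n) ℚᵘ.* toℚᵘ (ℕ→ℚ n)             ≈⟨ ℚᵘ.*-cong (toℚᵘ-fromℚᵘ (ℚᵘ.mkℚᵘ i n-1)) (toℚᵘ-fromℚᵘ (ℚᵘ.mkℚᵘ (+ n) 0)) ⟩
    ℚᵘ.mkℚᵘ i n-1 ℚᵘ.* ℚᵘ.mkℚᵘ (+ n) 0        ≈⟨ ℚᵘ.*≡* (ℤ.*-assoc i (+ n) (+ 1)) ⟩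
    ℚᵘ.mkℚᵘ i 0                                 ≈⟨ ℚᵘ.≃-sym (toℚᵘ-fromℚᵘ (ℚᵘ.mkℚᵘ i 0)) ⟩
    toℚᵘ (i / 1)                                ∎)
  where open ℚᵘ.≃-Reasoning

^ℚ-distribˡ-+-* : ∀ x m n → x ^ℚ (m + n) ≡ x ^ℚ m * x ^ℚ n
^ℚ-distribˡ-+-* x zero    n = sym (*-identityˡ (x ^ℚ n))
^ℚ-distribˡ-+-* x (suc m) n =
  trans (cong (x *_) (^ℚ-distribˡ-+-* x m n)) (sym (*-assoc x (x ^ℚ m) (x ^ℚ n)))

ξ[n+2k]≡ξ[n] : ∀ n k → ξ (n + 2 ℕ.* k) ≡ ξ n
ξ[n+2k]≡ξ[n] n k = trans (cong (λ j → ξ (n + j)) (ℕ.*-comm 2 k)) ([m+kn]%n≡m%n n k 2)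

Complementary : ℕ → ℕ → Set
Complementary x x′ = (x ≡ 0 × x′ ≡ 1) ⊎ (x ≡ 1 × x′ ≡ 0)

-- ξ (2 + n) and ξ n are definitionally equal, by the way _%_ is computed.
ξ-complementary : ∀ n → Complementary (ξ n) (ξ (suc n))
ξ-complementary zero = inj₁ (refl , refl)
ξ-complementary (suc n) with ξ-complementary n
... | inj₁ (ξ[n]≡0 , ξ[1+n]≡1) = inj₂ (ξ[1+n]≡1 , ξ[n]≡0)
... | inj₂ (ξ[n]≡1 , ξ[1+n]≡0) = inj₁ (ξ[1+n]≡0 , ξ[n]≡1)

complementary-identity : ∀ {x x′ y y′} → Complementary x x′ → Complementary y y′ →
  x′ + x ℕ.* y′ ≡ y′ + x′ ℕ.* y
complementary-identity (inj₁ (refl , refl)) (inj₁ (refl , refl)) = refl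
complementary-identity (inj₁ (refl , refl)) (inj₂ (refl , refl)) = refl
complementary-identity (inj₂ (refl , refl)) (inj₁ (refl , refl)) = refl
complementary-identity (inj₂ (refl , refl)) (inj₂ (refl , refl)) = refl

coef-cong-ξ : ∀ a b {m n} → ξ m ≡ ξ n → coef a b m ≡ coef a b n
coef-cong-ξ a b ξm≡ξn rewrite ξm≡ξn = refl

open ℚ-Solver using (solve; _:=_; _:+_; _:*_; _:-_; :-_; con)

-- The inductive step, with w (n + 2) = α w (n + 1) + C w n and v (k + 2) = β v (k + 1) + C v k
-- unfolded and z = (-C)^k.
combine-recurrences : ∀ {α β ρ ρ′ C z X W₀ W₁ V₀ V₁ : ℚ} → α * ρ′ ≡ β * ρ →
  α * (ρ′ * V₁ * X - ((- C) * z) * W₁) +ℚ C * (ρ * V₀ * X - z * (α * W₁ +ℚ C * W₀))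
    ≡ ρ * (β * V₁ +ℚ C * V₀) * X - ((- C) * ((- C) * z)) * W₀
combine-recurrences {α} {β} {ρ} {ρ′} {C} {z} {X} {W₀} {W₁} {V₀} {V₁} αρ′≡ρβ = begin
  α * (ρ′ * V₁ * X - ((- C) * z) * W₁) +ℚ C * (ρ * V₀ * X - z * (α * W₁ +ℚ C * W₀))
    ≡⟨ solve 10 (λ α ρ ρ′ C z X W₀ W₁ V₀ V₁ →
         α :* (ρ′ :* V₁ :* X :- ((:- C) :* z) :* W₁) :+ C :* (ρ :* V₀ :* X :- z :* (α :* W₁ :+ C :* W₀))
         := (α :* ρ′) :* V₁ :* X :+ C :* ρ :* V₀ :* X :- C :* C :* z :* W₀)
         refl α ρ ρ′ C z X W₀ W₁ V₀ V₁ ⟩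
  (α * ρ′) * V₁ * X +ℚ C * ρ * V₀ * X - C * C * z * W₀
    ≡⟨ cong (λ t → t * V₁ * X +ℚ C * ρ * V₀ * X - C * C * z * W₀) αρ′≡ρβ ⟩
  (β * ρ) * V₁ * X +ℚ C * ρ * V₀ * X - C * C * z * W₀
    ≡⟨ solve 8 (λ β ρ C z X W₀ V₀ V₁ →
         (β :* ρ) :* V₁ :* X :+ C :* ρ :* V₀ :* X :- C :* C :* z :* W₀
         := ρ :* (β :* V₁ :+ C :* V₀) :* X :- ((:- C) :* ((:- C) :* z)) :* W₀)
         refl β ρ C z X W₀ V₀ V₁ ⟩
  ρ * (β * V₁ +ℚ C * V₀) * X - ((- C) * ((- C) * z)) * W₀ ∎
  where open ≡-Reasoning

module BiPeriodic (a b c : ℕ) .{{_ : NonZero b}} (w0 w1 : ℚ) where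

  W V : ℕ → ℚ
  W = biSeq a b c w0 w1
  V = lucas a b c

  B C r : ℚ
  B = ℕ→ℚ b
  C = ℕ→ℚ c
  r = + a / b

  α : ℕ → ℚ
  α n = ℕ→ℚ (coef a b n)

  ρ : ℕ → ℕ → ℚ
  ρ n k = r ^ℚ (ξ (suc n) ℕ.* ξ k)

  α≡b*r^ξ[1+n] : ∀ n → α n ≡ B * r ^ℚ ξ (suc n)
  α≡b*r^ξ[1+n] n with ξ-complementary n
  ... | inj₁ (ξ[n]≡0 , ξ[1+n]≡1) rewrite ξ[n]≡0 | ξ[1+n]≡1 =
    sym (trans (cong (B *_) (*-identityʳ r)) (trans (*-comm B r) (i/n*n≡i (+ a) b)))
  ... | inj₂ (ξ[n]≡1 , ξ[1+n]≡0) rewrite ξ[n]≡1 | ξ[1+n]≡0 = sym (*-identityʳ B)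

  α[n]*ρ[1+n,1+k]≡α[k]*ρ[n,k] : ∀ n k → α n * ρ (suc n) (suc k) ≡ α k * ρ n k
  α[n]*ρ[1+n,1+k]≡α[k]*ρ[n,k] n k = begin
    α n * ρ (suc n) (suc k)                           ≡⟨ cong (_* ρ (suc n) (suc k)) (α≡b*r^ξ[1+n] n) ⟩
    B * r ^ℚ ξ (suc n) * r ^ℚ (ξ n ℕ.* ξ (suc k))     ≡⟨ *-assoc B _ _ ⟩
    B * (r ^ℚ ξ (suc n) * r ^ℚ (ξ n ℕ.* ξ (suc k)))   ≡⟨ cong (B *_) (sym (^ℚ-distribˡ-+-* r (ξ (suc n)) _)) ⟩
    B * r ^ℚ (ξ (suc n) + ξ n ℕ.* ξ (suc k))          ≡⟨ cong (λ e → B * r ^ℚ e) exponents ⟩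
    B * r ^ℚ (ξ (suc k) + ξ (suc n) ℕ.* ξ k)          ≡⟨ cong (B *_) (^ℚ-distribˡ-+-* r (ξ (suc k)) _) ⟩
    B * (r ^ℚ ξ (suc k) * ρ n k)                      ≡⟨ sym (*-assoc B _ _) ⟩
    B * r ^ℚ ξ (suc k) * ρ n k                        ≡⟨ cong (_* ρ n k) (sym (α≡b*r^ξ[1+n] k)) ⟩
    α k * ρ n k                                       ∎
    where
    open ≡-Reasoning
    exponents : ξ (suc n) + ξ n ℕ.* ξ (suc k) ≡ ξ (suc k) + ξ (suc n) ℕ.* ξ k
    exponents = complementary-identity (ξ-complementary n) (ξ-complementary k)

  Identity : ℕ → ℕ → Set
  Identity k n = W (n + 2 ℕ.* k) ≡ ρ n k * V k * W (n + k) - ((- C) ^ℚ k) * W n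

  identity-step : ∀ k n → Identity (suc k) (suc n) → Identity k (2 + n) → Identity (2 + k) n
  identity-step k n ih₁ ih₀ = begin
    W (n + 2 ℕ.* (2 + k))                      ≡⟨ cong W (index-split n k) ⟩
    α m * W (suc m) +ℚ C * W m                 ≡⟨ cong (λ β → β * W (suc m) +ℚ C * W m) αm≡αn ⟩
    α n * W (suc m) +ℚ C * W m                 ≡⟨ cong₂ (λ u v → α n * u +ℚ C * v) ih₁′ ih₀′ ⟩
    α n * (ρ (suc n) (suc k) * V (suc k) * X - ((- C) * (- C) ^ℚ k) * W (suc n))
      +ℚ C * (ρ n k * V k * X - (- C) ^ℚ k * W (2 + n))
        ≡⟨ combine-recurrences {α n} {α k} {ρ n k} {ρ (suc n) (suc k)} {C} {(- C) ^ℚ k} {X}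
                              {W n} {W (suc n)} {V k} {V (suc k)} (α[n]*ρ[1+n,1+k]≡α[k]*ρ[n,k] n k) ⟩
    ρ n (2 + k) * V (2 + k) * X - ((- C) ^ℚ (2 + k)) * W n ∎
    where
    open ≡-Reasoning
    m : ℕ
    m = 2 + n + 2 ℕ.* k
    X : ℚ
    X = W (n + (2 + k))

    index-split : ∀ n k → n + 2 ℕ.* (2 + k) ≡ 2 + (2 + n + 2 ℕ.* k)
    index-split = solve-∀
    index-shift : ∀ n k → suc n + 2 ℕ.* suc k ≡ suc (2 + n + 2 ℕ.* k)
    index-shift = solve-∀
    middle-shift₁ : ∀ n k → suc n + suc k ≡ n + (2 + k)
    middle-shift₁ = solve-∀
    middle-shift₀ : ∀ n k → 2 + n + k ≡ n + (2 + k)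
    middle-shift₀ = solve-∀

    αm≡αn : α m ≡ α n
    αm≡αn = cong ℕ→ℚ (coef-cong-ξ a b {m} {n} (ξ[n+2k]≡ξ[n] n k))

    ih₁′ : W (suc m) ≡ ρ (suc n) (suc k) * V (suc k) * X - ((- C) * (- C) ^ℚ k) * W (suc n)
    ih₁′ = trans (cong W (sym (index-shift n k))) (trans ih₁
      (cong (λ j → ρ (suc n) (suc k) * V (suc k) * W j - ((- C) * (- C) ^ℚ k) * W (suc n)) (middle-shift₁ n k)))

    ih₀′ : W m ≡ ρ n k * V k * X - (- C) ^ℚ k * W (2 + n)
    ih₀′ = trans ih₀ (cong (λ j → ρ n k * V k * W j - (- C) ^ℚ k * W (2 + n)) (middle-shift₀ n k))

  identity-zero : ∀ n → Identity 0 n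
  identity-zero n rewrite ℕ.*-zeroʳ (ξ (suc n)) | ℕ.+-identityʳ n =
    solve 1 (λ w → w := con 1ℚ :* (con 1ℚ :+ con 1ℚ) :* w :- con 1ℚ :* w) refl (W n)

  identity-one : ∀ n → Identity 1 n
  identity-one n rewrite ℕ.*-identityʳ (ξ (suc n)) | ℕ.+-comm n 2 | ℕ.+-comm n 1 = begin
    α n * W (suc n) +ℚ C * W n
      ≡⟨ cong (λ β → β * W (suc n) +ℚ C * W n) (α≡b*r^ξ[1+n] n) ⟩
    B * r ^ℚ ξ (suc n) * W (suc n) +ℚ C * W n
      ≡⟨ solve 5 (λ B p w₁ C w₀ → B :* p :* w₁ :+ C :* w₀ := p :* B :* w₁ :- ((:- C) :* con 1ℚ) :* w₀)
           refl B (r ^ℚ ξ (suc n)) (W (suc n)) C (W n) ⟩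
    r ^ℚ ξ (suc n) * B * W (suc n) - ((- C) * 1ℚ) * W n ∎
    where open ≡-Reasoning

  identity : ∀ k n → Identity k n
  identity zero          n = identity-zero n
  identity (suc zero)    n = identity-one n
  identity (suc (suc k)) n = identity-step k n (identity (suc k) (suc n)) (identity k (2 + n))

lemma2 : (a b c : ℕ) → .{{_ : NonZero a}} → .{{_ : NonZero b}} → .{{_ : NonZero c}} →
    (w0 w1 : ℚ) → (n k : ℕ) → k ≥ 1 →
    biSeq a b c w0 w1 (n + 2 ℕ.* k)
      ≡ ((+ a / b) ^ℚ (ξ (n + 1) ℕ.* ξ k)) * lucas a b c k * biSeq a b c w0 w1 (n + k)
        - ((- ℕ→ℚ c) ^ℚ k) * biSeq a b c w0 w1 n
lemma2 a b c w0 w1 n k _ rewrite ℕ.+-comm n 1 = BiPeriodic.identity a b c w0 w1 k n
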